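{- Let $\mathcal{T}$ be a formula tree and let $S\subseteq R$ be sets of nodes of $\mathcal{T}$. Then $\mathcal{T}^{R}\Rightarrow\mathcal{T}^{S}$, i.e. for every assignment $\nu$ of truth values to boxes, if the value of $\mathcal{T}^R$ under $\nu$ is true then the value of $\mathcal{T}^S$ under $\nu$ is true.
   Context: Boxes are subsets of $Q\times Q$ for a finite set $Q$. A formula tree is a (possibly infinite) rooted tree whose leaves are labeled by boxes and whose inner nodes are labeled by $\wedge$ or $\vee$ and have at least one child; the empty tree is identified with $\mathit{false}$ (its value is false). Given an assignment $\nu$ from boxes to $\{\mathit{true},\mathit{false}\}$, let $e_\nu$ be the set of leaves whose box $\nu$ maps to true. For a set $e$ of nodes, the one-step propagation $p(e)$ is $e$ together with all $\vee$-nodes having some child in $e$ and all $\wedge$-nodes all of whose children are in $e$. The value of the tree under $\nu$ is true iff the root lies in $\bigcup_{i\in\mathbb{N}}p^i(e_\nu)$. For a set $S$ of nodes, the prefix $\mathcal{T}^S$ is obtained by (1) marking all subtrees with root in $S$, (2) repeating until a fixed point: marking every $\vee$-node all of whose children are marked and every $\wedge$-node some child of which is marked, together with their subtrees, (3) deleting all marked nodes. -}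

module Defs where

open import Data.Nat using (ℕ; zero; suc)
open import Data.Fin using (Fin)
open import Data.Bool using (Bool; true)
open import Data.Product using (Σ; ∃; _×_; _,_; proj₁)
open import Data.Sum using (_⊎_)
open import Relation.Nullary using (¬_)
open import Relation.Binary.PropositionalEquality using (_≡_)

-- A box is a subset of Q × Q, for the finite set Q = Fin q.
Box : ℕ → Set
Box q = Fin q → Fin q → Bool

data Label (q : ℕ) : Set where
  leaf : Box q → Label q
  and  : Label q
  or   : Label q

-- A (possibly infinite, possibly infinitely branching) rooted labelled
-- graph; `child m n` means n is a child of m.
record RawTree (q : ℕ) : Set₁ where
  field
    Node  : Set
    root  : Node
    child : Node → Node → Set
    label : Node → Label q
open RawTree public

data Reach {q} (T : RawTree q) : Node T → Node T → Set where
  here : ∀ {m} → Reach T m m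
  step : ∀ {m k n} → child T m k → Reach T k n → Reach T m n

record IsFormulaTree {q} (T : RawTree q) : Set where
  field
    root-no-parent : ∀ m → ¬ child T m (root T)
    unique-parent  : ∀ {m m' n} → child T m n → child T m' n → m ≡ m'
    reachable      : ∀ n → Reach T (root T) n
    leaf-no-child  : ∀ {n b c} → label T n ≡ leaf b → ¬ child T n c
    and-has-child  : ∀ {n} → label T n ≡ and → ∃ λ c → child T n c
    or-has-child   : ∀ {n} → label T n ≡ or → ∃ λ c → child T n c

Assignment : ℕ → Set
Assignment q = Box q → Bool

-- Prop T ν i n  :  n ∈ p^i(e_ν)
Prop : ∀ {q} (T : RawTree q) → Assignment q → ℕ → Node T → Set
Prop T ν zero n = Σ _ λ b → (label T n ≡ leaf b) × (ν b ≡ true)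
Prop T ν (suc i) n =
  Prop T ν i n
  ⊎ ((label T n ≡ or)  × (∃ λ c → child T n c × Prop T ν i c))
  ⊎ ((label T n ≡ and) × (∀ c → child T n c → Prop T ν i c))

-- Value of a (nonempty) tree under ν: root ∈ ⋃_i p^i(e_ν).
Value : ∀ {q} (T : RawTree q) → Assignment q → Set
Value T ν = ∃ λ i → Prop T ν i (root T)

-- Marked nodes for the prefix T^S: the least fixed point of the marking
-- process (1)+(2).
data Marked {q} (T : RawTree q) (S : Node T → Set) : Node T → Set where
  inS     : ∀ {n} → S n → Marked T S n
  subtree : ∀ {m n} → Marked T S m → child T m n → Marked T S n
  orAll   : ∀ {n} → label T n ≡ or → (∀ c → child T n c → Marked T S c) → Marked T S n
  andSome : ∀ {n c} → label T n ≡ and → child T n c → Marked T S c → Marked T S n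

-- The prefix T^S (step (3): delete marked nodes), given that the root
-- survives (otherwise T^S is the empty tree).
prune : ∀ {q} (T : RawTree q) (S : Node T → Set) → ¬ Marked T S (root T) → RawTree q
prune T S h = record
  { Node  = Σ (Node T) λ n → ¬ Marked T S n
  ; root  = root T , h
  ; child = λ m n → child T (proj₁ m) (proj₁ n)
  ; label = λ n → label T (proj₁ n)
  }

-- Value of T^S under ν; the empty tree (root marked) has value false.
PrefixValue : ∀ {q} (T : RawTree q) (S : Node T → Set) → Assignment q → Set
PrefixValue T S ν = Σ (¬ Marked T S (root T)) λ h → Value (prune T S h) ν

module Submission where

-- Enlarging the seed set only marks more nodes, so T^R is T^S with further
-- nodes deleted. Truth propagates upwards from T^R to T^S step by step: an
-- ∨-node keeps its true child, and an ∧-node surviving in T^R has no marked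
-- child at all, so its children in T^S are exactly its children in T^R.
-- None of the tree axioms is needed.

open import Defs
open import Data.Nat using (ℕ; zero; suc)
open import Data.Product using (_,_)
open import Data.Sum using (inj₁; inj₂)
open import Relation.Nullary using (¬_)

module _ {q} (T : RawTree q) {S R : Node T → Set} (S⊆R : ∀ n → S n → R n) where

  Marked-mono : ∀ {n} → Marked T S n → Marked T R n
  Marked-mono (inS s)          = inS (S⊆R _ s)
  Marked-mono (subtree m c)    = subtree (Marked-mono m) c
  Marked-mono (orAll l cs)     = orAll l (λ c ch → Marked-mono (cs c ch))
  Marked-mono (andSome l ch m) = andSome l ch (Marked-mono m)

  unmarked-antitone : ∀ {n} → ¬ Marked T R n → ¬ Marked T S n
  unmarked-antitone ¬r s = ¬r (Marked-mono s)

  module _ (ν : Assignment q) (rootR : ¬ Marked T R (root T)) (rootS : ¬ Marked T S (root T)) where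

    prune-Prop-mono : ∀ i {n} (¬r : ¬ Marked T R n) (¬s : ¬ Marked T S n)
                    → Prop (prune T R rootR) ν i (n , ¬r)
                    → Prop (prune T S rootS) ν i (n , ¬s)
    prune-Prop-mono zero    ¬r ¬s p        = p
    prune-Prop-mono (suc i) ¬r ¬s (inj₁ p) = inj₁ (prune-Prop-mono i ¬r ¬s p)
    prune-Prop-mono (suc i) ¬r ¬s (inj₂ (inj₁ (l , (c , ¬rc) , ch , p))) =
      inj₂ (inj₁ (l , (c , ¬sc) , ch , prune-Prop-mono i ¬rc ¬sc p))
      where
        ¬sc : ¬ Marked T S c
        ¬sc = unmarked-antitone ¬rc
    prune-Prop-mono (suc i) ¬r ¬s (inj₂ (inj₂ (l , all))) =
      inj₂ (inj₂ (l , λ { (c , ¬sc) ch →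
        let ¬rc : ¬ Marked T R c
            ¬rc m = ¬r (andSome l ch m)
        in prune-Prop-mono i ¬rc ¬sc (all (c , ¬rc) ch) }))

lemma11 : (q : ℕ) (T : RawTree q) → IsFormulaTree T
          → (S R : Node T → Set) → (∀ n → S n → R n)
          → (ν : Assignment q) → PrefixValue T R ν → PrefixValue T S ν
lemma11 q T _ S R S⊆R ν (rootR , i , p) =
  rootS , i , prune-Prop-mono T S⊆R ν rootR rootS i rootR rootS p
  where
    rootS : ¬ Marked T S (root T)
    rootS = unmarked-antitone T S⊆R rootR
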